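{- Let $G$ be a triangular grid graph, let $G'$ be a boundary subdivision of $G$, and let $\vec{G'}$ be any smart orientation of $G'$. Then $\vec{G'}$ contains no shortcut; that is, there is no directed path $v_1\to v_2\to\cdots\to v_k$ in $\vec{G'}$ together with an arc $v_1\to v_k$ such that for some $1\le i<j\le k$ the arc $v_i\to v_j$ is absent.
   Context: The triangular tiling graph $T^\infty$ has vertices $(x,y)\in\mathbb{Z}^2$ placed at $(x+y/2, y\sqrt3/2)$, adjacent iff at Euclidean distance $1$; its triangular faces are cells. A triangular grid graph $G$ is obtained by specifying finitely many cells and taking all edges bounding them (and their endpoints). A cell belongs to $G$ if all its edges are in $G$. A boundary edge is an edge of $G$ lying on a cell of $T^\infty$ not belonging to $G$ (it then lies on exactly one cell of $G$); a boundary cell is a cell of $G$ incident to at least one boundary edge. Subdividing a cell means adding a new vertex (its center) inside it adjacent to exactly the three vertices of the cell. A boundary subdivision of $G$ is obtained by subdividing some set of boundary cells of $G$ only. Each cell is either upward (vertices: top $t$, bottom-left $l$, bottom-right $r$) or downward (vertices: top-left $p$, top-right $q$, bottom $s$). Types of boundary edges: for an upward cell of $G$, its bottom, left and right sides, when boundary edges, have types S, NW, NE respectively; for a downward cell of $G$, its top, left and right sides, when boundary edges, have types N, SW, SE respectively. The property set of a boundary cell is the set of types of its boundary edges. A smart orientation of a boundary subdivision $G'$ of $G$ is an orientation such that: (1) every edge of $G$ (grid edge) that is horizontal is directed from left to right, and every non-horizontal edge of $G$ is directed from its higher endpoint to its lower endpoint; (2) for each subdivided cell with center $z$, the three edges at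 $z$ are directed according to one of the following six types, chosen to correspond to some element of the cell's property set (NW$\to$A, NE$\to$B, S$\to$C, SE$\to$a, SW$\to$b, N$\to$c): for an upward cell, type A: $t\to z$, $z\to l$, $z\to r$; type B: $t\to z$, $l\to z$, $r\to z$; type C: $t\to z$, $l\to z$, $z\to r$; for a downward cell, type a: $p\to z$, $q\to z$, $z\to s$; type b: $z\to p$, $z\to q$, $z\to s$; type c: $p\to z$, $z\to q$, $z\to s$. -}

module Defs where

open import Data.Integer using (ℤ; suc; pred)
open import Data.Nat using (ℕ; _<_)
open import Data.List using (List; _∷_; [])
open import Data.List.Membership.Propositional using (_∈_)
open import Data.Product using (Σ; _×_; _,_)
open import Data.Sum using (_⊎_)
open import Data.Empty using (⊥)
open import Relation.Nullary using (¬_)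
open import Relation.Binary.PropositionalEquality using (_≡_)

-- Lattice coordinates: vertex (x,y) sits at (x + y/2, y√3/2).
-- Cells of T∞:
--   up x y   : l = (x,y), r = (x+1,y), t = (x,y+1)
--   down x y : p = (x,y+1), q = (x+1,y+1), s = (x+1,y)
data Cell : Set where
  up   : ℤ → ℤ → Cell
  down : ℤ → ℤ → Cell

-- Edges of T∞, each with a unique canonical name:
--   h x y : (x,y) — (x+1,y)      (horizontal)
--   a x y : (x,y) — (x,y+1)
--   b x y : (x,y) — (x-1,y+1)
data Edge : Set where
  h : ℤ → ℤ → Edge
  a : ℤ → ℤ → Edge
  b : ℤ → ℤ → Edge

-- Vertices of a boundary subdivision: grid vertices and cell centers.
data V : Set where
  grid   : ℤ → ℤ → V
  center : Cell → V

-- Direction of grid edges required by smart orientations: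
-- horizontal edges left to right, others from higher to lower endpoint.
src : Edge → V
src (h x y) = grid x y
src (a x y) = grid x (suc y)
src (b x y) = grid (pred x) (suc y)

tgt : Edge → V
tgt (h x y) = grid (suc x) y
tgt (a x y) = grid x y
tgt (b x y) = grid x y

upBottom upLeft upRight : ℤ → ℤ → Edge
upBottom x y = h x y
upLeft   x y = a x y
upRight  x y = b (suc x) y
downTop downLeft downRight : ℤ → ℤ → Edge
downTop   x y = h x (suc y)
downLeft  x y = b (suc x) y
downRight x y = a (suc x) y

cellEdges : Cell → List Edge
cellEdges (up x y)   = upBottom x y ∷ upLeft x y ∷ upRight x y ∷ []
cellEdges (down x y) = downTop x y ∷ downLeft x y ∷ downRight x y ∷ []

cellVerts : Cell → List V
cellVerts (up x y)   = grid x (suc y) ∷ grid x y ∷ grid (suc x) y ∷ []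
cellVerts (down x y) = grid x (suc y) ∷ grid (suc x) (suc y) ∷ grid (suc x) y ∷ []

-- A triangular grid graph G is given by a finite list of specified cells.
GridGraph : Set
GridGraph = List Cell

InG : GridGraph → Edge → Set
InG G e = Σ Cell λ c → c ∈ G × e ∈ cellEdges c

CellOf : GridGraph → Cell → Set
CellOf G c = ∀ e → e ∈ cellEdges c → InG G e

BoundaryEdge : GridGraph → Edge → Set
BoundaryEdge G e = InG G e × Σ Cell λ c → e ∈ cellEdges c × ¬ CellOf G c

BoundaryCell : GridGraph → Cell → Set
BoundaryCell G c = CellOf G c × Σ Edge λ e → e ∈ cellEdges c × BoundaryEdge G e

data BType : Set where
  NW NE S SE SW N : BType

Props : GridGraph → Cell → BType → Set
Props G (up x y)   NW = BoundaryEdge G (upLeft x y)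
Props G (up x y)   NE = BoundaryEdge G (upRight x y)
Props G (up x y)   S  = BoundaryEdge G (upBottom x y)
Props G (up x y)   _  = ⊥
Props G (down x y) N  = BoundaryEdge G (downTop x y)
Props G (down x y) SW = BoundaryEdge G (downLeft x y)
Props G (down x y) SE = BoundaryEdge G (downRight x y)
Props G (down x y) _  = ⊥

-- Edges of the boundary subdivision G' of G, where Sub is the set of
-- subdivided cells (as unordered pairs).
EdgeG' : GridGraph → (Cell → Set) → V → V → Set
EdgeG' G Sub u v =
  (Σ Edge λ e → InG G e × ((u ≡ src e × v ≡ tgt e) ⊎ (u ≡ tgt e × v ≡ src e)))
  ⊎ (Σ Cell λ c → Sub c × Σ V λ w → w ∈ cellVerts c ×
       ((u ≡ center c × v ≡ w) ⊎ (u ≡ w × v ≡ center c)))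

IsBoundarySubdivision : GridGraph → (Cell → Set) → Set
IsBoundarySubdivision G Sub = ∀ c → Sub c → BoundaryCell G c

IsOrientation : GridGraph → (Cell → Set) → (V → V → Set) → Set
IsOrientation G Sub Arc =
  (∀ u v → Arc u v → EdgeG' G Sub u v)
  × (∀ u v → EdgeG' G Sub u v → Arc u v ⊎ Arc v u)
  × (∀ u v → Arc u v → ¬ Arc v u)

-- Direction pattern at the center z of a subdivided cell, for a type
-- (NW→A, NE→B, S→C, SE→a, SW→b, N→c).
Conforms : (V → V → Set) → Cell → BType → Set
Conforms Arc (up x y) NW =
  Arc (grid x (suc y)) z × Arc z (grid x y) × Arc z (grid (suc x) y)
  where z = center (up x y)
Conforms Arc (up x y) NE =
  Arc (grid x (suc y)) z × Arc (grid x y) z × Arc (grid (suc x) y) z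
  where z = center (up x y)
Conforms Arc (up x y) S  =
  Arc (grid x (suc y)) z × Arc (grid x y) z × Arc z (grid (suc x) y)
  where z = center (up x y)
Conforms Arc (up x y) _ = ⊥
Conforms Arc (down x y) SE =
  Arc (grid x (suc y)) z × Arc (grid (suc x) (suc y)) z × Arc z (grid (suc x) y)
  where z = center (down x y)
Conforms Arc (down x y) SW =
  Arc z (grid x (suc y)) × Arc z (grid (suc x) (suc y)) × Arc z (grid (suc x) y)
  where z = center (down x y)
Conforms Arc (down x y) N  =
  Arc (grid x (suc y)) z × Arc z (grid (suc x) (suc y)) × Arc z (grid (suc x) y)
  where z = center (down x y)
Conforms Arc (down x y) _ = ⊥

IsSmartOrientation : GridGraph → (Cell → Set) → (V → V → Set) → Set
IsSmartOrientation G Sub Arc =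
  IsOrientation G Sub Arc
  × (∀ e → InG G e → Arc (src e) (tgt e))
  × (∀ c → Sub c → Σ BType λ τ → Props G c τ × Conforms Arc c τ)

HasShortcut : (V → V → Set) → Set
HasShortcut Arc =
  Σ ℕ λ k → Σ (ℕ → V) λ v →
    (∀ i → Data.Nat.suc i < k → Arc (v i) (v (Data.Nat.suc i)))
    × (∀ i j → i < k → j < k → v i ≡ v j → i ≡ j)
    × Arc (v 0) (v (k Data.Nat.∸ 1))
    × Σ ℕ λ i → Σ ℕ λ j → i < j × j < k × ¬ Arc (v i) (v j)

module Submission where

-- Grid arcs are steps east or downwards (Step), so they increase the
-- coordinatewise order _⊑_.  The centre of a subdivided cell is inserted at a
-- slot of the order c₀ → c₁ → c₂ of its corners (Placement), so the four
-- vertices of the cell form a transitive tournament, and the slot marks a side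
-- as boundary edge.  Hence the grid vertices of a directed path move along ⊑
-- (monotone).  If the ends u, w of a path are joined by a grid arc, a grid
-- vertex inside the path is a middle corner m of a cell d = (u m w) (squeeze),
-- which leaves the shapes u z w, u m w, u m z w, u z m w (Shape); in the last
-- two, z passes a non-diagonal side of d, which is then a boundary edge and
-- lies in only one cell of G, so z is the centre of d.  A chord leaving or
-- entering a centre reduces to a grid chord inside its cell.  So a chordal
-- path has at most four vertices and all forward arcs (fourVertices, chordal).

open import Defs
open import Data.Integer as ℤ using (ℤ) renaming (_≤_ to _≤ℤ_)
import Data.Integer.Properties as ℤP
open import Data.Nat using (ℕ; zero; suc; _<_; _≤_; z≤n; s≤s; _≤?_; _<?_; _∸_; _+_)
import Data.Nat.Properties as ℕP
open import Data.List.Membership.Propositional using (_∈_)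
open import Data.List.Relation.Unary.Any using (here; there)
open import Data.Product using (Σ; _×_; _,_; proj₁; proj₂)
open import Data.Sum using (_⊎_; inj₁; inj₂)
open import Data.Empty using (⊥; ⊥-elim)
open import Data.Unit using (⊤; tt)
open import Function using (_∘_)
open import Relation.Nullary using (¬_; Dec; yes; no)
open import Relation.Nullary.Decidable using (True; toWitness)
open import Relation.Binary.PropositionalEquality

-- Inequalities between numerals (possibly plus a variable) are decided by
-- computation; the instance of ⊤ lets instance search supply the witness.
instance
  unit : ⊤
  unit = tt

≤! : ∀ {m n} {{_ : True (m ≤? n)}} → m ≤ n
≤! {{t}} = toWitness t

suc≰ : ∀ {i} → ¬ (ℤ.suc i ≤ℤ i)
suc≰ p = ℤP.<-irrefl refl (ℤP.suc[i]≤j⇒i<j p)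

i≢pred[i] : ∀ {i} → i ≢ ℤ.pred i
i≢pred[i] e = ℤP.i≢suc[i] (trans (sym e) (sym (ℤP.suc-pred _)))

between : ∀ {x w} → x ≤ℤ w → w ≤ℤ ℤ.suc x → w ≡ x ⊎ w ≡ ℤ.suc x
between {x} {w} p q with w ℤ.≟ x
... | yes e = inj₁ e
... | no w≢x = inj₂ (ℤP.≤-antisym q (ℤP.i<j⇒suc[i]≤j (ℤP.≤∧≢⇒< p (w≢x ∘ sym))))

-- Vertices.  The unit square with top-left corner T x y is cut by its
-- diagonal T → R into the cells up x y = T L R and down x y = T Q R.

T L R Q : ℤ → ℤ → V
T x y = grid x (ℤ.suc y)
L x y = grid x y
R x y = grid (ℤ.suc x) y
Q x y = grid (ℤ.suc x) (ℤ.suc y)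

IsGrid : V → Set
IsGrid w = Σ ℤ λ i → Σ ℤ λ j → w ≡ grid i j

IsCentre : V → Set
IsCentre w = Σ Cell λ c → w ≡ center c

kind : ∀ w → IsGrid w ⊎ IsCentre w
kind (grid i j) = inj₁ (i , j , refl)
kind (center c) = inj₂ (c , refl)

gridNotCentre : ∀ {w} → IsGrid w → IsCentre w → ⊥
gridNotCentre (_ , _ , refl) (_ , ())

gridEq : ∀ {i j k l} → grid i j ≡ grid k l → i ≡ k × j ≡ l
gridEq refl = refl , refl

_⊑_ : V → V → Set
grid i j ⊑ grid k l = i ≤ℤ k × l ≤ℤ j
grid _ _ ⊑ center _ = ⊥
center _ ⊑ _ = ⊥

⊑-refl : ∀ {u} → IsGrid u → u ⊑ u
⊑-refl (_ , _ , refl) = ℤP.≤-refl , ℤP.≤-refl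

⊑-trans : ∀ {u w x} → u ⊑ w → w ⊑ x → u ⊑ x
⊑-trans {grid _ _} {grid _ _} {grid _ _} (p , q) (r , s) = ℤP.≤-trans p r , ℤP.≤-trans s q

data Step : V → V → Set where
  stepH : ∀ x y → Step (L x y) (R x y)
  stepA : ∀ x y → Step (T x y) (L x y)
  stepB : ∀ x y → Step (T x y) (R x y)

edgeOf : ∀ {u w} → Step u w → Edge
edgeOf (stepH x y) = h x y
edgeOf (stepA x y) = a x y
edgeOf (stepB x y) = b (ℤ.suc x) y

srcEdge : ∀ {u w} (s : Step u w) → src (edgeOf s) ≡ u
srcEdge (stepH x y) = refl
srcEdge (stepA x y) = refl
srcEdge (stepB x y) = cong (λ t → grid t (ℤ.suc y)) (ℤP.pred-suc x)

tgtEdge : ∀ {u w} (s : Step u w) → tgt (edgeOf s) ≡ w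
tgtEdge (stepH x y) = refl
tgtEdge (stepA x y) = refl
tgtEdge (stepB x y) = refl

edgeStep : ∀ e → Step (src e) (tgt e)
edgeStep (h x y) = stepH x y
edgeStep (a x y) = stepA x y
edgeStep (b x y) = subst (λ t → Step (T (ℤ.pred x) y) (grid t y)) (ℤP.suc-pred x) (stepB (ℤ.pred x) y)

stepSource : ∀ {u w} → Step u w → IsGrid u
stepSource (stepH x y) = _ , _ , refl
stepSource (stepA x y) = _ , _ , refl
stepSource (stepB x y) = _ , _ , refl

stepTarget : ∀ {u w} → Step u w → IsGrid w
stepTarget (stepH x y) = _ , _ , refl
stepTarget (stepA x y) = _ , _ , refl
stepTarget (stepB x y) = _ , _ , refl

stepOrder : ∀ {u w} → Step u w → u ⊑ w
stepOrder (stepH x y) = ℤP.i≤suc[i] x , ℤP.≤-refl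
stepOrder (stepA x y) = ℤP.≤-refl , ℤP.i≤suc[i] y
stepOrder (stepB x y) = ℤP.i≤suc[i] x , ℤP.i≤suc[i] y

stepStrict : ∀ {u w} → Step u w → ¬ (w ⊑ u)
stepStrict (stepH x y) (p , _) = suc≰ p
stepStrict (stepA x y) (_ , q) = suc≰ q
stepStrict (stepB x y) (p , _) = suc≰ p

stepDistinct : ∀ {u w} → Step u w → u ≢ w
stepDistinct s refl = stepStrict s (⊑-refl (stepSource s))

stepEdge : ∀ {u w e} (s : Step u w) → u ≡ src e → w ≡ tgt e → edgeOf s ≡ e
stepEdge {e = h _ _} (stepH x y) refl refl = refl
stepEdge {e = a _ _} (stepH x y) eu refl = ⊥-elim (ℤP.i≢suc[i] (proj₁ (gridEq eu)))
stepEdge {e = b _ _} (stepH x y) eu refl = ⊥-elim (ℤP.i≢suc[i] (proj₂ (gridEq eu)))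
stepEdge {e = h _ _} (stepA x y) refl ew = ⊥-elim (ℤP.i≢suc[i] (proj₁ (gridEq ew)))
stepEdge {e = a _ _} (stepA x y) _ refl = refl
stepEdge {e = b _ _} (stepA x y) eu refl = ⊥-elim (i≢pred[i] (proj₁ (gridEq eu)))
stepEdge {e = h _ _} (stepB x y) refl ew = ⊥-elim (ℤP.i≢suc[i] (proj₂ (gridEq ew)))
stepEdge {e = a _ _} (stepB x y) eu refl = ⊥-elim (ℤP.i≢suc[i] (proj₁ (gridEq eu)))
stepEdge {e = b _ _} (stepB x y) _ refl = refl

-- Middle s m : m is a grid vertex strictly inside the box spanned by the step
-- s.  Only the diagonal step has such vertices: the middle corners L and Q.
Middle : ∀ {u w} → Step u w → V → Set
Middle (stepB x y) m = m ≡ L x y ⊎ m ≡ Q x y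
Middle _ _ = ⊥

squeeze : ∀ {u w m} (s : Step u w) → u ⊑ m → m ⊑ w → m ≢ u → m ≢ w → Middle s m
squeeze {m = center _} (stepH _ _) ()
squeeze {m = center _} (stepA _ _) ()
squeeze {m = center _} (stepB _ _) ()
squeeze {m = grid _ _} (stepH x y) (p₁ , p₂) (q₁ , q₂) m≢u m≢w
  with ℤP.≤-antisym q₂ p₂ | between p₁ q₁
... | refl | inj₁ refl = m≢u refl
... | refl | inj₂ refl = m≢w refl
squeeze {m = grid _ _} (stepA x y) (p₁ , p₂) (q₁ , q₂) m≢u m≢w
  with ℤP.≤-antisym p₁ q₁ | between q₂ p₂
... | refl | inj₁ refl = m≢w refl
... | refl | inj₂ refl = m≢u refl
squeeze {m = grid _ _} (stepB x y) (p₁ , p₂) (q₁ , q₂) m≢u m≢w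
  with between p₁ q₁ | between q₂ p₂
... | inj₁ refl | inj₁ refl = inj₁ refl
... | inj₁ refl | inj₂ refl = ⊥-elim (m≢u refl)
... | inj₂ refl | inj₁ refl = ⊥-elim (m≢w refl)
... | inj₂ refl | inj₂ refl = inj₂ refl

middleAntichain : ∀ {u w m m'} (s : Step u w) → Middle s m → Middle s m' → m ⊑ m' → m ≡ m'
middleAntichain (stepB x y) (inj₁ refl) (inj₁ refl) _ = refl
middleAntichain (stepB x y) (inj₁ refl) (inj₂ refl) (_ , q) = ⊥-elim (suc≰ q)
middleAntichain (stepB x y) (inj₂ refl) (inj₁ refl) (p , _) = ⊥-elim (suc≰ p)
middleAntichain (stepB x y) (inj₂ refl) (inj₂ refl) _ = refl

-- Cells and their corners, listed in the order of the grid arcs between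
-- them: c₀ → c₁ → c₂ and c₀ → c₂.

data Corner : Set where
  c₀ c₁ c₂ : Corner

corner : Cell → Corner → V
corner (up x y)   c₀ = T x y
corner (up x y)   c₁ = L x y
corner (up x y)   c₂ = R x y
corner (down x y) c₀ = T x y
corner (down x y) c₁ = Q x y
corner (down x y) c₂ = R x y

cornerOf : ∀ {c w} → w ∈ cellVerts c → Σ Corner λ i → w ≡ corner c i
cornerOf {up _ _}   (here refl)                 = c₀ , refl
cornerOf {up _ _}   (there (here refl))         = c₁ , refl
cornerOf {up _ _}   (there (there (here refl))) = c₂ , refl
cornerOf {up _ _}   (there (there (there ())))
cornerOf {down _ _} (here refl)                 = c₀ , refl
cornerOf {down _ _} (there (here refl))         = c₁ , refl
cornerOf {down _ _} (there (there (here refl))) = c₂ , refl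
cornerOf {down _ _} (there (there (there ())))

cornerMem : ∀ c i → corner c i ∈ cellVerts c
cornerMem (up _ _)   c₀ = here refl
cornerMem (up _ _)   c₁ = there (here refl)
cornerMem (up _ _)   c₂ = there (there (here refl))
cornerMem (down _ _) c₀ = here refl
cornerMem (down _ _) c₁ = there (here refl)
cornerMem (down _ _) c₂ = there (there (here refl))

memGrid : ∀ {c w} → w ∈ cellVerts c → IsGrid w
memGrid {up _ _}   (here refl)                 = _ , _ , refl
memGrid {up _ _}   (there (here refl))         = _ , _ , refl
memGrid {up _ _}   (there (there (here refl))) = _ , _ , refl
memGrid {up _ _}   (there (there (there ())))
memGrid {down _ _} (here refl)                 = _ , _ , refl
memGrid {down _ _} (there (here refl))         = _ , _ , refl
memGrid {down _ _} (there (there (here refl))) = _ , _ , refl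
memGrid {down _ _} (there (there (there ())))

data _≺_ : Corner → Corner → Set where
  0≺1 : c₀ ≺ c₁
  0≺2 : c₀ ≺ c₂
  1≺2 : c₁ ≺ c₂

compareCorners : ∀ i j → i ≺ j ⊎ i ≡ j ⊎ j ≺ i
compareCorners c₀ c₀ = inj₂ (inj₁ refl)
compareCorners c₀ c₁ = inj₁ 0≺1
compareCorners c₀ c₂ = inj₁ 0≺2
compareCorners c₁ c₀ = inj₂ (inj₂ 0≺1)
compareCorners c₁ c₁ = inj₂ (inj₁ refl)
compareCorners c₁ c₂ = inj₁ 1≺2
compareCorners c₂ c₀ = inj₂ (inj₂ 0≺2)
compareCorners c₂ c₁ = inj₂ (inj₂ 1≺2)
compareCorners c₂ c₂ = inj₂ (inj₁ refl)

rank : Corner → ℕ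
rank c₀ = 0
rank c₁ = 1
rank c₂ = 2

≺-rank : ∀ {i j} → i ≺ j → rank i < rank j
≺-rank 0≺1 = ≤!
≺-rank 0≺2 = ≤!
≺-rank 1≺2 = ≤!

rank-≺ : ∀ {i j} → rank i < rank j → i ≺ j
rank-≺ {i} {j} r with compareCorners i j
... | inj₁ p = p
... | inj₂ (inj₁ refl) = ⊥-elim (ℕP.<-irrefl refl r)
... | inj₂ (inj₂ p) = ⊥-elim (ℕP.<-asym r (≺-rank p))

sideStep : ∀ c {i j} → i ≺ j → Step (corner c i) (corner c j)
sideStep (up x y)   0≺1 = stepA x y
sideStep (up x y)   0≺2 = stepB x y
sideStep (up x y)   1≺2 = stepH x y
sideStep (down x y) 0≺1 = stepH x (ℤ.suc y)
sideStep (down x y) 0≺2 = stepB x y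
sideStep (down x y) 1≺2 = stepA (ℤ.suc x) y

side : ∀ c {i j} → i ≺ j → Edge
side c p = edgeOf (sideStep c p)

sideMem : ∀ c {i j} (p : i ≺ j) → side c p ∈ cellEdges c
sideMem (up _ _)   0≺1 = there (here refl)
sideMem (up _ _)   0≺2 = there (there (here refl))
sideMem (up _ _)   1≺2 = here refl
sideMem (down _ _) 0≺1 = here refl
sideMem (down _ _) 0≺2 = there (here refl)
sideMem (down _ _) 1≺2 = there (there (here refl))

-- The b-edges are the diagonals of the unit squares; in every cell the
-- diagonal is the side c₀c₂.
IsDiagonal : Edge → Set
IsDiagonal (b _ _) = ⊤
IsDiagonal _ = ⊥

isDiagonal? : ∀ e → Dec (IsDiagonal e)
isDiagonal? (h _ _) = no λ ()
isDiagonal? (a _ _) = no λ ()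
isDiagonal? (b _ _) = yes tt

diagonal₀₂ : ∀ c → IsDiagonal (side c 0≺2)
diagonal₀₂ (up _ _) = tt
diagonal₀₂ (down _ _) = tt

straight₀₁ : ∀ c → ¬ IsDiagonal (side c 0≺1)
straight₀₁ (up _ _) ()
straight₀₁ (down _ _) ()

straight₁₂ : ∀ c → ¬ IsDiagonal (side c 1≺2)
straight₁₂ (up _ _) ()
straight₁₂ (down _ _) ()

cornerOrder : ∀ c {i j} → corner c i ⊑ corner c j → corner c i ≢ corner c j → i ≺ j
cornerOrder c {i} {j} le ne with compareCorners i j
... | inj₁ p = p
... | inj₂ (inj₁ refl) = ⊥-elim (ne refl)
... | inj₂ (inj₂ p) = ⊥-elim (stepStrict (sideStep c p) le)

record SideAt (c : Cell) (u w : V) (e : Edge) : Set where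
  constructor sideAt
  field
    {from to} : Corner
    order     : from ≺ to
    atSource  : u ≡ corner c from
    atTarget  : w ≡ corner c to
    isSide    : side c order ≡ e

stepSide : ∀ {c u w} → u ∈ cellVerts c → w ∈ cellVerts c → (s : Step u w) → SideAt c u w (edgeOf s)
stepSide {c} mu mw s with cornerOf mu | cornerOf mw
... | _ , refl | _ , refl = sideAt p refl refl (stepEdge (sideStep c p) (sym (srcEdge s)) (sym (tgtEdge s)))
  where p = cornerOrder c (stepOrder s) (stepDistinct s)

stepInCell : ∀ {c u w} → u ∈ cellVerts c → w ∈ cellVerts c → (s : Step u w) →
             edgeOf s ∈ cellEdges c
stepInCell {c} mu mw s = subst (_∈ cellEdges c) isSide (sideMem c order)
  where open SideAt (stepSide mu mw s)

Triangle : Cell → V → V → V → Set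
Triangle d u m w = u ≡ corner d c₀ × m ≡ corner d c₁ × w ≡ corner d c₂

middleTriangle : ∀ {u w m} (s : Step u w) → Middle s m → Σ Cell λ d → Triangle d u m w
middleTriangle (stepB x y) (inj₁ refl) = up x y , refl , refl , refl
middleTriangle (stepB x y) (inj₂ refl) = down x y , refl , refl , refl

-- The side marked as boundary edge when the centre of c sits at slot n of the
-- corner order: between c₀ and c₁ (n = 1), between c₁ and c₂ (n = 2), or
-- before or after all corners (the diagonal).
slotSide : Cell → ℕ → Edge
slotSide c 1 = side c 0≺1
slotSide c 2 = side c 1≺2
slotSide c _ = side c 0≺2

slotSideBeyond : ∀ c {n} → 3 ≤ n → slotSide c n ≡ side c 0≺2
slotSideBeyond c (s≤s (s≤s (s≤s _))) = refl

cellFromSides : ∀ G c → InG G (side c 0≺1) → InG G (side c 1≺2) → InG G (side c 0≺2) → CellOf G c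
cellFromSides G (up _ _)   _   g₁₂ _   _ (here refl)                 = g₁₂
cellFromSides G (up _ _)   g₀₁ _   _   _ (there (here refl))         = g₀₁
cellFromSides G (up _ _)   _   _   g₀₂ _ (there (there (here refl))) = g₀₂
cellFromSides G (up _ _)   _   _   _   _ (there (there (there ())))
cellFromSides G (down _ _) g₀₁ _   _   _ (here refl)                 = g₀₁
cellFromSides G (down _ _) _   _   g₀₂ _ (there (here refl))         = g₀₂
cellFromSides G (down _ _) _   g₁₂ _   _ (there (there (here refl))) = g₁₂
cellFromSides G (down _ _) _   _   _   _ (there (there (there ())))

upCellOf downCellOf : Edge → Cell
upCellOf (h x y) = up x y
upCellOf (a x y) = up x y
upCellOf (b x y) = up (ℤ.pred x) y
downCellOf (h x y) = down x (ℤ.pred y)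
downCellOf (a x y) = down (ℤ.pred x) y
downCellOf (b x y) = down (ℤ.pred x) y

cellsOfEdge : ∀ {e c} → e ∈ cellEdges c → c ≡ upCellOf e ⊎ c ≡ downCellOf e
cellsOfEdge {c = up x y}   (here refl)                 = inj₁ refl
cellsOfEdge {c = up x y}   (there (here refl))         = inj₁ refl
cellsOfEdge {c = up x y}   (there (there (here refl))) = inj₁ (cong (λ t → up t y) (sym (ℤP.pred-suc x)))
cellsOfEdge {c = up x y}   (there (there (there ())))
cellsOfEdge {c = down x y} (here refl)                 = inj₂ (cong (down x) (sym (ℤP.pred-suc y)))
cellsOfEdge {c = down x y} (there (here refl))         = inj₂ (cong (λ t → down t y) (sym (ℤP.pred-suc x)))
cellsOfEdge {c = down x y} (there (there (here refl))) = inj₂ (cong (λ t → down t y) (sym (ℤP.pred-suc x)))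
cellsOfEdge {c = down x y} (there (there (there ())))

-- A boundary edge is a side of at most one cell of G: of its two cells one
-- is not in G.
boundaryUnique : ∀ {G e c c'} → BoundaryEdge G e → e ∈ cellEdges c → e ∈ cellEdges c' →
                 CellOf G c → CellOf G c' → c ≡ c'
boundaryUnique {G} (_ , _ , m'' , outside) m m' g g'
  with cellsOfEdge m | cellsOfEdge m' | cellsOfEdge m''
... | inj₁ e | inj₁ e' | _       = trans e (sym e')
... | inj₂ e | inj₂ e' | _       = trans e (sym e')
... | inj₁ e | inj₂ _  | inj₁ e'' = ⊥-elim (outside (subst (CellOf G) (trans e (sym e'')) g))
... | inj₁ _ | inj₂ e' | inj₂ e'' = ⊥-elim (outside (subst (CellOf G) (trans e' (sym e'')) g'))
... | inj₂ e | inj₁ _  | inj₂ e'' = ⊥-elim (outside (subst (CellOf G) (trans e (sym e'')) g))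
... | inj₂ _ | inj₁ e' | inj₁ e'' = ⊥-elim (outside (subst (CellOf G) (trans e' (sym e'')) g'))

module SmartOrientation (G : GridGraph) (Sub : Cell → Set) (bs : IsBoundarySubdivision G Sub)
                        (Arc : V → V → Set) (sm : IsSmartOrientation G Sub Arc) where

  asym : ∀ {u w} → Arc u w → Arc w u → ⊥
  asym p q = proj₂ (proj₂ (proj₁ sm)) _ _ p q

  subCell : ∀ {c} → Sub c → CellOf G c
  subCell s = proj₁ (bs _ s)

  data ArcView (u w : V) : Set where
    edgeArc   : (e : Edge) → InG G e → u ≡ src e → w ≡ tgt e → ArcView u w
    centreOut : (c : Cell) → Sub c → u ≡ center c → w ∈ cellVerts c → ArcView u w
    centreIn  : (c : Cell) → Sub c → w ≡ center c → u ∈ cellVerts c → ArcView u w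

  arcView : ∀ {u w} → Arc u w → ArcView u w
  arcView {u} {w} p with proj₁ (proj₁ sm) u w p
  ... | inj₁ (e , g , inj₁ (eu , ew)) = edgeArc e g eu ew
  ... | inj₁ (e , g , inj₂ (eu , ew)) =
    ⊥-elim (asym p (subst₂ Arc (sym ew) (sym eu) (proj₁ (proj₂ sm) e g)))
  ... | inj₂ (c , s , _ , m , inj₁ (eu , ew)) = centreOut c s eu (subst (_∈ cellVerts c) (sym ew) m)
  ... | inj₂ (c , s , _ , m , inj₂ (eu , ew)) = centreIn c s ew (subst (_∈ cellVerts c) (sym eu) m)

  leaving : ∀ {c w} → Arc (center c) w → Sub c × w ∈ cellVerts c
  leaving p with arcView p
  ... | edgeArc e _ eu _ = ⊥-elim (gridNotCentre (stepSource (edgeStep e)) (_ , sym eu))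
  ... | centreOut _ s refl m = s , m
  ... | centreIn _ _ _ m = ⊥-elim (gridNotCentre (memGrid m) (_ , refl))

  entering : ∀ {c u} → Arc u (center c) → Sub c × u ∈ cellVerts c
  entering p with arcView p
  ... | edgeArc e _ _ ew = ⊥-elim (gridNotCentre (stepTarget (edgeStep e)) (_ , sym ew))
  ... | centreOut _ _ _ m = ⊥-elim (gridNotCentre (memGrid m) (_ , refl))
  ... | centreIn _ s refl m = s , m

  leavingGrid : ∀ {z w} → IsCentre z → Arc z w → IsGrid w
  leavingGrid (_ , refl) p = memGrid (proj₂ (leaving p))

  enteringGrid : ∀ {u z} → IsCentre z → Arc u z → IsGrid u
  enteringGrid (_ , refl) p = memGrid (proj₂ (entering p))

  stepArc : ∀ {u w} (s : Step u w) → InG G (edgeOf s) → Arc u w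
  stepArc s g = subst₂ Arc (srcEdge s) (tgtEdge s) (proj₁ (proj₂ sm) _ g)

  arcInG : ∀ {u w} (s : Step u w) → Arc u w → InG G (edgeOf s)
  arcInG s p with arcView p
  ... | edgeArc e g eu ew = subst (InG G) (sym (stepEdge s eu ew)) g
  ... | centreOut c _ eu _ = ⊥-elim (gridNotCentre (stepSource s) (c , eu))
  ... | centreIn c _ ew _ = ⊥-elim (gridNotCentre (stepTarget s) (c , ew))

  arcStep : ∀ {u w} → IsGrid u → IsGrid w → Arc u w → Step u w
  arcStep gu gw p with arcView p
  ... | edgeArc e _ eu ew = subst₂ Step (sym eu) (sym ew) (edgeStep e)
  ... | centreOut c _ eu _ = ⊥-elim (gridNotCentre gu (c , eu))
  ... | centreIn c _ ew _ = ⊥-elim (gridNotCentre gw (c , ew))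

  cornerArc : ∀ {c i j} → CellOf G c → i ≺ j → Arc (corner c i) (corner c j)
  cornerArc {c} g p = stepArc (sideStep c p) (g _ (sideMem c p))

  cornerRank : ∀ {c i j} → CellOf G c → Arc (corner c i) (corner c j) → i ≺ j
  cornerRank {i = i} {j} g p with compareCorners i j
  ... | inj₁ q = q
  ... | inj₂ (inj₁ refl) = ⊥-elim (asym p p)
  ... | inj₂ (inj₂ q) = ⊥-elim (asym p (cornerArc g q))

  cellArc : ∀ {c u w} → CellOf G c → u ∈ cellVerts c → w ∈ cellVerts c → u ⊑ w → u ≢ w →
            Step u w × Arc u w
  cellArc {c} g mu mw le ne with cornerOf mu | cornerOf mw
  ... | _ , refl | _ , refl = sideStep c p , cornerArc g p
    where p = cornerOrder c le ne

  -- The centre of a subdivided cell is inserted at a slot of the corner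
  -- order: corners of rank below the slot point to it, the others are
  -- pointed to.  The type of the cell marks the side at the slot as a
  -- boundary edge.
  record Placement (c : Cell) : Set where
    field
      slot     : ℕ
      inward   : ∀ i → rank i < slot → Arc (corner c i) (center c)
      outward  : ∀ i → slot ≤ rank i → Arc (center c) (corner c i)
      boundary : BoundaryEdge G (slotSide c slot)
  open Placement

  placement : ∀ {c} → Sub c → Placement c
  placement {up x y} s with proj₂ (proj₂ sm) _ s
  ... | NW , bd , (tz , zl , zr) = record
    { slot = 1 ; boundary = bd
    ; inward = λ { c₀ _ → tz ; c₁ (s≤s ()) ; c₂ (s≤s ()) }
    ; outward = λ { c₀ () ; c₁ _ → zl ; c₂ _ → zr } }
  ... | NE , bd , (tz , lz , rz) = record
    { slot = 3 ; boundary = bd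
    ; inward = λ { c₀ _ → tz ; c₁ _ → lz ; c₂ _ → rz }
    ; outward = λ { c₀ () ; c₁ (s≤s ()) ; c₂ (s≤s (s≤s ())) } }
  ... | S , bd , (tz , lz , zr) = record
    { slot = 2 ; boundary = bd
    ; inward = λ { c₀ _ → tz ; c₁ _ → lz ; c₂ (s≤s (s≤s ())) }
    ; outward = λ { c₀ () ; c₁ (s≤s ()) ; c₂ _ → zr } }
  ... | SE , _ , ()
  ... | SW , _ , ()
  ... | N , _ , ()
  placement {down x y} s with proj₂ (proj₂ sm) _ s
  ... | SE , bd , (pz , qz , zs) = record
    { slot = 2 ; boundary = bd
    ; inward = λ { c₀ _ → pz ; c₁ _ → qz ; c₂ (s≤s (s≤s ())) }
    ; outward = λ { c₀ () ; c₁ (s≤s ()) ; c₂ _ → zs } }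
  ... | SW , bd , (zp , zq , zs) = record
    { slot = 0 ; boundary = bd
    ; inward = λ _ ()
    ; outward = λ { c₀ _ → zp ; c₁ _ → zq ; c₂ _ → zs } }
  ... | N , bd , (pz , zq , zs) = record
    { slot = 1 ; boundary = bd
    ; inward = λ { c₀ _ → pz ; c₁ (s≤s ()) ; c₂ (s≤s ()) }
    ; outward = λ { c₀ () ; c₁ _ → zq ; c₂ _ → zs } }
  ... | NW , _ , ()
  ... | NE , _ , ()
  ... | S , _ , ()

  inwardRank : ∀ {c i} (s : Sub c) → Arc (corner c i) (center c) → rank i < slot (placement s)
  inwardRank {i = i} s p with rank i <? slot (placement s)
  ... | yes q = q
  ... | no q = ⊥-elim (asym p (outward (placement s) i (ℕP.≮⇒≥ q)))

  outwardRank : ∀ {c i} (s : Sub c) → Arc (center c) (corner c i) → slot (placement s) ≤ rank i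
  outwardRank {i = i} s p with slot (placement s) ≤? rank i
  ... | yes q = q
  ... | no q = ⊥-elim (asym p (inward (placement s) i (ℕP.≰⇒> q)))

  -- Transitivity of the tournament on the four vertices of a subdivided cell.
  throughCentre : ∀ {c u w} → Arc u (center c) → Arc (center c) w → Arc u w
  throughCentre p q with entering p | leaving q
  ... | s , mu | _ , mw with cornerOf mu | cornerOf mw
  ...   | _ , refl | _ , refl =
    cornerArc (subCell s) (rank-≺ (ℕP.<-≤-trans (inwardRank s p) (outwardRank s q)))

  intoCentre : ∀ {c u w} → u ∈ cellVerts c → Arc u w → Arc w (center c) → Arc u (center c)
  intoCentre mu p q with entering q
  ... | s , mw with cornerOf mu | cornerOf mw
  ...   | i , refl | _ , refl =
    inward (placement s) i (ℕP.<-trans (≺-rank (cornerRank (subCell s) p)) (inwardRank s q))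

  outOfCentre : ∀ {c u w} → w ∈ cellVerts c → Arc (center c) u → Arc u w → Arc (center c) w
  outOfCentre mw p q with leaving p
  ... | s , mu with cornerOf mu | cornerOf mw
  ...   | _ , refl | j , refl =
    outward (placement s) j
      (ℕP.≤-trans (outwardRank s p) (ℕP.<⇒≤ (≺-rank (cornerRank (subCell s) q))))

  viaCentre : ∀ {u z w} → IsCentre z → Arc u z → Arc z w → Arc u w
  viaCentre (_ , refl) = throughCentre

  BoundarySide : Cell → Edge → Set
  BoundarySide c e = BoundaryEdge G e × e ∈ cellEdges c

  boundaryAt : ∀ {c e n} (s : Sub c) → slot (placement s) ≡ n → slotSide c n ≡ e → BoundaryEdge G e
  boundaryAt s refl refl = boundary (placement s)

  -- A centre entered from one end of a non-diagonal side of its cell and left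
  -- to the other end sits at the slot of that side, which is a boundary edge.
  passing : ∀ {c u w} (s : Step u w) → ¬ IsDiagonal (edgeOf s) →
            Arc u (center c) → Arc (center c) w → BoundarySide c (edgeOf s)
  passing {c} s straight p q with entering p | leaving q
  ... | sc , mu | _ , mw with stepSide mu mw s
  ... | sideAt 0≺1 refl refl eq =
    boundaryAt sc (ℕP.≤-antisym (outwardRank sc q) (inwardRank sc p)) eq , stepInCell mu mw s
  ... | sideAt 1≺2 refl refl eq =
    boundaryAt sc (ℕP.≤-antisym (outwardRank sc q) (inwardRank sc p)) eq , stepInCell mu mw s
  ... | sideAt 0≺2 _ _ eq = ⊥-elim (straight (subst IsDiagonal eq (diagonal₀₂ c)))

  -- A centre with arcs to both ends of a diagonal side sits before all
  -- corners, one with arcs from both ends after all corners; either way the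
  -- diagonal is a boundary edge.
  diagonalSource : ∀ {c u w} (s : Step u w) → IsDiagonal (edgeOf s) →
                   Arc (center c) u → Arc (center c) w → BoundarySide c (edgeOf s)
  diagonalSource {c} s diagonal p q with leaving p | leaving q
  ... | sc , mu | _ , mw with stepSide mu mw s
  ... | sideAt 0≺2 refl refl eq = boundaryAt sc (ℕP.n≤0⇒n≡0 (outwardRank sc p)) eq , stepInCell mu mw s
  ... | sideAt 0≺1 _ _ eq = ⊥-elim (straight₀₁ c (subst IsDiagonal (sym eq) diagonal))
  ... | sideAt 1≺2 _ _ eq = ⊥-elim (straight₁₂ c (subst IsDiagonal (sym eq) diagonal))

  diagonalSink : ∀ {c u w} (s : Step u w) → IsDiagonal (edgeOf s) →
                 Arc u (center c) → Arc w (center c) → BoundarySide c (edgeOf s)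
  diagonalSink {c} s diagonal p q with entering p | entering q
  ... | sc , mu | _ , mw with stepSide mu mw s
  ... | sideAt 0≺2 refl refl eq =
    boundaryAt sc refl (trans (slotSideBeyond c (inwardRank sc q)) eq) , stepInCell mu mw s
  ... | sideAt 0≺1 _ _ eq = ⊥-elim (straight₀₁ c (subst IsDiagonal (sym eq) diagonal))
  ... | sideAt 1≺2 _ _ eq = ⊥-elim (straight₁₂ c (subst IsDiagonal (sym eq) diagonal))

  sameCell : ∀ {c d e} → Sub c → BoundarySide c e → e ∈ cellEdges d → CellOf G d → c ≡ d
  sameCell s (bd , m) m' g = boundaryUnique bd m m' (subCell s) g

  triangleInG : ∀ {d u m w} → Triangle d u m w → Arc u m → Arc m w → Arc u w → CellOf G d
  triangleInG {d} (refl , refl , refl) um mw uw =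
    cellFromSides G d (arcInG (sideStep d 0≺1) um) (arcInG (sideStep d 1≺2) mw) (arcInG (sideStep d 0≺2) uw)

  centreInG : ∀ {d u y} → y ≡ center d → Arc u y → CellOf G d
  centreInG refl p = subCell (proj₁ (entering p))

  centreAfterMiddle : ∀ {d u m w y} → Triangle d u m w → IsCentre y →
                      Arc u m → Arc m y → Arc y w → Arc u w → y ≡ center d
  centreAfterMiddle {d} (refl , refl , refl) (_ , refl) um my yw uw =
    cong center (sameCell (proj₁ (entering my)) bd (sideMem d 1≺2)
      (cellFromSides G d (arcInG (sideStep d 0≺1) um) (proj₁ (proj₁ bd)) (arcInG (sideStep d 0≺2) uw)))
    where bd = passing (sideStep d 1≺2) (straight₁₂ d) my yw

  centreBeforeMiddle : ∀ {d u m w y} → Triangle d u m w → IsCentre y →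
                       Arc u y → Arc y m → Arc m w → Arc u w → y ≡ center d
  centreBeforeMiddle {d} (refl , refl , refl) (_ , refl) uy ym mw uw =
    cong center (sameCell (proj₁ (entering uy)) bd (sideMem d 0≺1)
      (cellFromSides G d (proj₁ (proj₁ bd)) (arcInG (sideStep d 1≺2) mw) (arcInG (sideStep d 0≺2) uw)))
    where bd = passing (sideStep d 0≺1) (straight₀₁ d) uy ym

  sourceOfTriangle : ∀ {d u m w z} → Triangle d u m w → IsCentre z →
                     Arc z u → Arc z w → CellOf G d → z ≡ center d
  sourceOfTriangle {d} (refl , _ , refl) (_ , refl) zu zw g =
    cong center (sameCell (proj₁ (leaving zu))
      (diagonalSource (sideStep d 0≺2) (diagonal₀₂ d) zu zw) (sideMem d 0≺2) g)

  sinkOfTriangle : ∀ {d u m w z} → Triangle d u m w → IsCentre z →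
                   Arc u z → Arc w z → CellOf G d → z ≡ center d
  sinkOfTriangle {d} (refl , _ , refl) (_ , refl) uz wz g =
    cong center (sameCell (proj₁ (entering uz))
      (diagonalSink (sideStep d 0≺2) (diagonal₀₂ d) uz wz) (sideMem d 0≺2) g)

  -- Once the centre is known, the missing arcs follow by transitivity.
  closeMiddleFirst : ∀ {d u m w z} → Triangle d u m w → z ≡ center d →
                     Arc u m → Arc m z → Arc z w → Arc u z × Arc m w
  closeMiddleFirst {d} (refl , refl , refl) refl um mz zw =
    intoCentre (cornerMem d c₀) um mz , throughCentre mz zw

  closeCentreFirst : ∀ {d u m w z} → Triangle d u m w → z ≡ center d →
                     Arc u z → Arc z m → Arc m w → Arc u m × Arc z w
  closeCentreFirst {d} (refl , refl , refl) refl uz zm mw =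
    throughCentre uz zm , outOfCentre (cornerMem d c₂) zm mw

  sourceMiddle : ∀ {d u m w z} → Triangle d u m w → IsCentre z →
                 Arc z u → Arc z w → Arc u m → Arc m w → Arc u w → Arc z m
  sourceMiddle {d} tri@(refl , refl , refl) cz zu zw um mw uw
    with sourceOfTriangle tri cz zu zw (triangleInG tri um mw uw)
  ... | refl = outOfCentre (cornerMem d c₁) zu um

  sinkMiddle : ∀ {d u m w z} → Triangle d u m w → IsCentre z →
               Arc u z → Arc w z → Arc u m → Arc m w → Arc u w → Arc m z
  sinkMiddle {d} tri@(refl , refl , refl) cz uz wz um mw uw
    with sinkOfTriangle tri cz uz wz (triangleInG tri um mw uw)
  ... | refl = intoCentre (cornerMem d c₁) mw wz

  throughSide : ∀ {c u w} → Arc u (center c) → Arc (center c) w → (s : Step u w) →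
                Sub c × edgeOf s ∈ cellEdges c
  throughSide p q s = proj₁ (entering p) , stepInCell (proj₂ (entering p)) (proj₂ (leaving q)) s

  fromSide : ∀ {c u w} → Arc (center c) u → Arc (center c) w → (s : Step u w) →
             Sub c × edgeOf s ∈ cellEdges c
  fromSide p q s = proj₁ (leaving p) , stepInCell (proj₂ (leaving p)) (proj₂ (leaving q)) s

  intoSide : ∀ {c u w} → Arc u (center c) → Arc w (center c) → (s : Step u w) →
             Sub c × edgeOf s ∈ cellEdges c
  intoSide p q s = proj₁ (entering p) , stepInCell (proj₂ (entering p)) (proj₂ (entering q)) s

  sameCentre : ∀ {c c' e} → Sub c → BoundarySide c e → Sub c' × e ∈ cellEdges c' → center c ≡ center c'
  sameCentre s bd (s' , m') = cong center (sameCell s bd m' (subCell s'))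

  -- Along a grid step u → w, a centre with arcs to (from) both u and w and a
  -- centre passed through from u to w coincide: the side is a boundary edge
  -- of one of their cells, by the diagonal lemmas resp. by passing.
  sourceAndPassage : ∀ {u w z y} (s : Step u w) → IsCentre z → IsCentre y →
                     Arc z u → Arc z w → Arc u y → Arc y w → z ≡ y
  sourceAndPassage s (_ , refl) (_ , refl) zu zw uy yw with isDiagonal? (edgeOf s)
  ... | yes diagonal = sameCentre (proj₁ (leaving zu)) (diagonalSource s diagonal zu zw) (throughSide uy yw s)
  ... | no straight = sym (sameCentre (proj₁ (entering uy)) (passing s straight uy yw) (fromSide zu zw s))

  sinkAndPassage : ∀ {u w z y} (s : Step u w) → IsCentre z → IsCentre y →
                   Arc u z → Arc w z → Arc u y → Arc y w → z ≡ y
  sinkAndPassage s (_ , refl) (_ , refl) uz wz uy yw with isDiagonal? (edgeOf s)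
  ... | yes diagonal = sameCentre (proj₁ (entering uz)) (diagonalSink s diagonal uz wz) (throughSide uy yw s)
  ... | no straight = sym (sameCentre (proj₁ (entering uy)) (passing s straight uy yw) (intoSide uz wz s))

  sourceClosure : ∀ {z u w} → IsCentre z → Arc z u → Arc z w → u ⊑ w → u ≢ w →
                  Step u w × Arc u w
  sourceClosure (_ , refl) zu zw =
    cellArc (subCell (proj₁ (leaving zu))) (proj₂ (leaving zu)) (proj₂ (leaving zw))

  sinkClosure : ∀ {z u w} → IsCentre z → Arc u z → Arc w z → u ⊑ w → u ≢ w →
                Step u w × Arc u w
  sinkClosure (_ , refl) uz wz =
    cellArc (subCell (proj₁ (entering uz))) (proj₂ (entering uz)) (proj₂ (entering wz))

  record Path (k : ℕ) (v : ℕ → V) : Set where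
    field
      step     : ∀ i → suc i < k → Arc (v i) (v (suc i))
      distinct : ∀ i j → i < k → j < k → v i ≡ v j → i ≡ j

  tail : ∀ {k v} → Path (suc k) v → Path k (λ i → v (suc i))
  tail P = record
    { step = λ i p → step (suc i) (s≤s p)
    ; distinct = λ i j p q e → ℕP.suc-injective (distinct (suc i) (suc j) (s≤s p) (s≤s q) e) }
    where open Path P

  init : ∀ {k v} → Path (suc k) v → Path k v
  init P = record
    { step = λ i p → step i (ℕP.m<n⇒m<1+n p)
    ; distinct = λ i j p q → distinct i j (ℕP.m<n⇒m<1+n p) (ℕP.m<n⇒m<1+n q) }
    where open Path P

  data Shape (v : ℕ → V) : ℕ → Set where
    oneCentre        : IsCentre (v 1) → Shape v 2
    oneMiddle        : (d : Cell) → Triangle d (v 0) (v 1) (v 2) → Shape v 2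
    middleThenCentre : (d : Cell) → Triangle d (v 0) (v 1) (v 3) → v 2 ≡ center d → Shape v 3
    centreThenMiddle : (d : Cell) → Triangle d (v 0) (v 2) (v 3) → v 1 ≡ center d → Shape v 3

  module _ {k : ℕ} {v : ℕ → V} (P : Path k v) where
    open Path P

    apart : ∀ i j → i < k → j < k → i ≢ j → v i ≢ v j
    apart i j p q i≢j e = i≢j (distinct i j p q e)

    gridNeighbour : ∀ i → suc i < k → IsGrid (v i) ⊎ IsGrid (v (suc i))
    gridNeighbour i p with kind (v i)
    ... | inj₁ g = inj₁ g
    ... | inj₂ c = inj₂ (leavingGrid c (step i p))

    arcBelow : ∀ {m} → m < k → ∀ i {{_ : True (suc i ≤? m)}} → Arc (v i) (v (suc i))
    arcBelow bound i = step i (ℕP.≤-<-trans ≤! bound)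

    monotone : ∀ {i} j → i ≤ j → j < k → IsGrid (v i) → IsGrid (v j) → v i ⊑ v j
    monotone {i} j i≤j j<k gi gj with ℕP.m≤n⇒m<n∨m≡n i≤j
    ... | inj₂ refl = ⊑-refl gi
    monotone (suc j) _ j<k gi gj | inj₁ (s≤s i≤j) with kind (v j)
    ... | inj₁ gm = ⊑-trans (monotone j i≤j (ℕP.<⇒≤ j<k) gi gm) (stepOrder (arcStep gm gj (step j j<k)))
    ... | inj₂ cm with ℕP.m≤n⇒m<n∨m≡n i≤j
    ...   | inj₂ refl = ⊥-elim (gridNotCentre gi cm)
    monotone (suc (suc j)) _ j<k gi gj | inj₁ _ | inj₂ cm | inj₁ (s≤s i≤j) =
      ⊑-trans (monotone j i≤j (ℕP.<⇒≤ j<k') gi gm)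
              (stepOrder (arcStep gm gj (viaCentre cm (step j j<k') (step (suc j) j<k))))
      where j<k' = ℕP.<⇒≤ j<k
            gm = enteringGrid cm (step j j<k')

    insideStep : ∀ {i m} (s : Step (v 0) (v m)) → 0 < i → i < m → m < k →
                 IsGrid (v i) → Middle s (v i)
    insideStep {i} {m} s 0<i i<m m<k gi =
      squeeze s (monotone i z≤n i<k (stepSource s) gi) (monotone m (ℕP.<⇒≤ i<m) m<k gi (stepTarget s))
              (apart i 0 i<k (ℕP.≤-<-trans z≤n i<k) (ℕP.>⇒≢ 0<i)) (apart i m i<k m<k (ℕP.<⇒≢ i<m))
      where i<k = ℕP.<-trans i<m m<k

    oneInside : ∀ {i j m} (s : Step (v 0) (v m)) → 0 < i → i < j → j < m → m < k →
                IsGrid (v i) → IsGrid (v j) → ⊥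
    oneInside {i} {j} s 0<i i<j j<m m<k gi gj =
      apart i j (ℕP.<-trans i<j j<k) j<k (ℕP.<⇒≢ i<j)
        (middleAntichain s (insideStep s 0<i (ℕP.<-trans i<j j<m) m<k gi)
                           (insideStep s (ℕP.<-trans 0<i i<j) j<m m<k gj)
                           (monotone j (ℕP.<⇒≤ i<j) j<k gi gj))
      where j<k = ℕP.<-trans j<m m<k

    shape : ∀ m → 2 ≤ m → m < k → (s : Step (v 0) (v m)) → Arc (v 0) (v m) → Shape v m
    shape 1 (s≤s ())
    shape 2 _ bound s chord with kind (v 1)
    ... | inj₂ z₁ = oneCentre z₁
    ... | inj₁ g₁ = let (d , tri) = middleTriangle s (insideStep {1} s ≤! ≤! bound g₁) in oneMiddle d tri
    shape 3 _ bound s chord with kind (v 1) | kind (v 2)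
    ... | inj₂ z₁ | inj₂ z₂ = ⊥-elim (gridNotCentre (leavingGrid z₁ (arcBelow bound 1)) z₂)
    ... | inj₁ g₁ | inj₁ g₂ = ⊥-elim (oneInside {1} {2} s ≤! ≤! ≤! bound g₁ g₂)
    ... | inj₁ g₁ | inj₂ z₂ =
      let (d , tri) = middleTriangle s (insideStep {1} s ≤! ≤! bound g₁)
      in middleThenCentre d tri
           (centreAfterMiddle tri z₂ (arcBelow bound 0) (arcBelow bound 1) (arcBelow bound 2) chord)
    ... | inj₂ z₁ | inj₁ g₂ =
      let (d , tri) = middleTriangle s (insideStep {2} s ≤! ≤! bound g₂)
      in centreThenMiddle d tri
           (centreBeforeMiddle tri z₁ (arcBelow bound 0) (arcBelow bound 1) (arcBelow bound 2) chord)
    shape 4 _ bound s chord with kind (v 2)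
    ... | inj₂ z₂ = ⊥-elim (oneInside {1} {3} s ≤! ≤! ≤! bound
                      (enteringGrid z₂ (arcBelow bound 1)) (leavingGrid z₂ (arcBelow bound 2)))
    ... | inj₁ g₂ with kind (v 1) | kind (v 3)
    ...   | inj₁ g₁ | _ = ⊥-elim (oneInside {1} {2} s ≤! ≤! ≤! bound g₁ g₂)
    ...   | _ | inj₁ g₃ = ⊥-elim (oneInside {2} {3} s ≤! ≤! ≤! bound g₂ g₃)
    ...   | inj₂ z₁ | inj₂ z₃ =
      let (d , tri) = middleTriangle s (insideStep {2} s ≤! ≤! bound g₂)
          m→w = viaCentre z₃ (arcBelow bound 2) (arcBelow bound 3)
          u→m = viaCentre z₁ (arcBelow bound 0) (arcBelow bound 1)
          y₁ = centreBeforeMiddle tri z₁ (arcBelow bound 0) (arcBelow bound 1) m→w chord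
          y₃ = centreAfterMiddle tri z₃ u→m (arcBelow bound 2) (arcBelow bound 3) chord
      in ⊥-elim (apart 1 3 (ℕP.≤-<-trans ≤! bound) (ℕP.≤-<-trans ≤! bound) (λ ()) (trans y₁ (sym y₃)))
    shape (suc (suc (suc (suc (suc m))))) _ bound s chord
      with gridNeighbour 1 (ℕP.≤-<-trans ≤! bound) | gridNeighbour 3 (ℕP.≤-<-trans ≤! bound)
    ... | inj₁ g₁ | inj₁ g₃ = ⊥-elim (oneInside {1} {3} s ≤! ≤! ≤! bound g₁ g₃)
    ... | inj₁ g₁ | inj₂ g₄ = ⊥-elim (oneInside {1} {4} s ≤! ≤! ≤! bound g₁ g₄)
    ... | inj₂ g₂ | inj₁ g₃ = ⊥-elim (oneInside {2} {3} s ≤! ≤! ≤! bound g₂ g₃)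
    ... | inj₂ g₂ | inj₂ g₄ = ⊥-elim (oneInside {2} {4} s ≤! ≤! ≤! bound g₂ g₄)

  gridCase : ∀ {n v} → Path (4 + n) v → Shape v (3 + n) → n ≡ 0 × Arc (v 0) (v 2) × Arc (v 1) (v 3)
  gridCase P (middleThenCentre d tri e) = refl , closeMiddleFirst tri e (step 0 ≤!) (step 1 ≤!) (step 2 ≤!)
    where open Path P
  gridCase P (centreThenMiddle d tri e) = refl , closeCentreFirst tri e (step 0 ≤!) (step 1 ≤!) (step 2 ≤!)
    where open Path P

  sourceCase : ∀ {n v} → Path (4 + n) v → IsCentre (v 0) → Arc (v 0) (v (3 + n)) →
               (s : Step (v 1) (v (3 + n))) → Arc (v 1) (v (3 + n)) → Shape (λ i → v (suc i)) (2 + n) →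
               n ≡ 0 × Arc (v 0) (v 2) × Arc (v 1) (v 3)
  sourceCase P cz chord s uw (oneCentre cy) =
    ⊥-elim (apart P 0 2 ≤! ≤! (λ ())
      (sourceAndPassage s cz cy (step 0 ≤!) chord (step 1 ≤!) (step 2 ≤!)))
    where open Path P
  sourceCase P cz chord s uw (oneMiddle d tri) =
    refl , sourceMiddle tri cz (step 0 ≤!) chord (step 1 ≤!) (step 2 ≤!) uw , uw
    where open Path P
  sourceCase P cz chord s uw (middleThenCentre d tri e) =
    ⊥-elim (apart P 0 3 ≤! ≤! (λ ())
      (trans (sourceOfTriangle tri cz (step 0 ≤!) chord (centreInG e (step 2 ≤!))) (sym e)))
    where open Path P
  sourceCase P cz chord s uw (centreThenMiddle d tri e) =
    ⊥-elim (apart P 0 2 ≤! ≤! (λ ())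
      (trans (sourceOfTriangle tri cz (step 0 ≤!) chord (centreInG e (step 1 ≤!))) (sym e)))
    where open Path P

  sinkCase : ∀ {n v} → Path (4 + n) v → IsCentre (v (3 + n)) → Arc (v 0) (v (3 + n)) →
             (s : Step (v 0) (v (2 + n))) → Arc (v 0) (v (2 + n)) → Shape v (2 + n) →
             n ≡ 0 × Arc (v 0) (v 2) × Arc (v 1) (v 3)
  sinkCase P cz chord s uw (oneCentre cy) =
    ⊥-elim (apart P 3 1 ≤! ≤! (λ ())
      (sinkAndPassage s cz cy chord (step 2 ≤!) (step 0 ≤!) (step 1 ≤!)))
    where open Path P
  sinkCase P cz chord s uw (oneMiddle d tri) =
    refl , uw , sinkMiddle tri cz chord (step 2 ≤!) (step 0 ≤!) (step 1 ≤!) uw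
    where open Path P
  sinkCase P cz chord s uw (middleThenCentre d tri e) =
    ⊥-elim (apart P 4 2 ≤! ≤! (λ ())
      (trans (sinkOfTriangle tri cz chord (step 3 ≤!) (centreInG e (step 1 ≤!))) (sym e)))
    where open Path P
  sinkCase P cz chord s uw (centreThenMiddle d tri e) =
    ⊥-elim (apart P 4 1 ≤! ≤! (λ ())
      (trans (sinkOfTriangle tri cz chord (step 3 ≤!) (centreInG e (step 0 ≤!))) (sym e)))
    where open Path P

  fourVertices : ∀ n {v} → Path (4 + n) v → Arc (v 0) (v (3 + n)) →
                 n ≡ 0 × Arc (v 0) (v 2) × Arc (v 1) (v 3)
  fourVertices n {v} P chord with kind (v 0) | kind (v (3 + n))
  ... | inj₂ cz | _ =
    let (s , uw) = sourceClosure cz (step 0 ≤!) chord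
                     (monotone P (3 + n) ≤! ℕP.≤-refl (leavingGrid cz (step 0 ≤!)) (leavingGrid cz chord))
                     (apart P 1 (3 + n) ≤! ℕP.≤-refl (λ ()))
    in sourceCase P cz chord s uw (shape (tail P) (2 + n) ≤! ℕP.≤-refl s uw)
    where open Path P
  ... | inj₁ _ | inj₂ cz =
    let (s , uw) = sinkClosure cz chord (step (2 + n) ℕP.≤-refl)
                     (monotone P (2 + n) z≤n (ℕP.n≤1+n _)
                        (enteringGrid cz chord) (enteringGrid cz (step (2 + n) ℕP.≤-refl)))
                     (apart P 0 (2 + n) ≤! (ℕP.n≤1+n _) (λ ()))
    in sinkCase P cz chord s uw (shape (init P) (2 + n) ≤! ℕP.≤-refl s uw)
    where open Path P
  ... | inj₁ g₀ | inj₁ gₘ = gridCase P (shape P (3 + n) ≤! ℕP.≤-refl (arcStep g₀ gₘ chord) chord)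

  skipArc : ∀ k {v} → Path k v → Arc (v 0) (v (k ∸ 1)) →
            ∀ {i j} → i < j → suc j < k → Arc (v i) (v (suc j))
  skipArc 3 P chord {0} {1} _ _ = chord
  skipArc (suc (suc (suc (suc n)))) {v} P chord i<j j<k with fourVertices n P chord
  ... | refl , a₀₂ , a₁₃ = pick i<j j<k
    where
    pick : ∀ {i j} → i < j → suc j < 4 → Arc (v i) (v (suc j))
    pick {0} {1} _ _ = a₀₂
    pick {0} {2} _ _ = chord
    pick {1} {2} _ _ = a₁₃
    pick {_} {suc (suc (suc _))} _ (s≤s (s≤s (s≤s (s≤s ()))))
    pick {suc (suc _)} {suc (suc zero)} (s≤s (s≤s ())) _
    pick {suc _} {suc zero} (s≤s ()) _
    pick {_} {zero} () _
  skipArc 3 P chord {_} {zero} () _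
  skipArc 3 P chord {suc _} {suc zero} (s≤s ()) _
  skipArc 3 P chord {_} {suc (suc _)} _ (s≤s (s≤s (s≤s ())))
  skipArc 2 P chord {_} {zero} () _
  skipArc 2 P chord {_} {suc _} _ (s≤s (s≤s ()))
  skipArc 1 P chord _ (s≤s ())
  skipArc 0 P chord _ ()

  chordal : ∀ k {v} → Path k v → Arc (v 0) (v (k ∸ 1)) →
            ∀ {i j} → i < j → j < k → Arc (v i) (v j)
  chordal k P chord {i} {suc j} (s≤s i≤j) j<k with ℕP.m≤n⇒m<n∨m≡n i≤j
  ... | inj₂ refl = Path.step P i j<k
  ... | inj₁ i<j = skipArc k P chord i<j j<k

lemma2 : (G : GridGraph) (Sub : Cell → Set) → IsBoundarySubdivision G Sub →
    (Arc : V → V → Set) → IsSmartOrientation G Sub Arc → ¬ HasShortcut Arc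
lemma2 G Sub bs Arc sm (k , v , step , distinct , chord , i , j , i<j , j<k , missing) =
  missing (chordal k (record { step = step ; distinct = distinct }) chord i<j j<k)
  where open SmartOrientation G Sub bs Arc sm
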